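{- Let $G$ be a finite chordal graph and let $v$ be a simplicial vertex of $G$. If $G$ has exactly two independent simplicial vertices, then either $G\setminus v$ is chordal and has exactly two independent simplicial vertices, or $G\setminus v$ is a complete graph.
   Context: A graph is chordal if it has no induced cycle of length greater than $3$. A vertex is simplicial if its neighbourhood induces a complete subgraph. "$G$ has exactly two independent simplicial vertices" means that the maximum cardinality of a set of pairwise non-adjacent simplicial vertices of $G$ is $2$. $G\setminus v$ denotes the graph obtained by deleting $v$ and its incident edges. -}

module Defs where

open import Data.Nat using (ℕ; zero; suc; _≤_)
open import Data.Fin using (Fin; toℕ; punchIn)
open import Data.Fin.Subset using (Subset; _∈_; ∣_∣)
open import Data.Bool using (Bool; true; false)
open import Data.Product using (Σ; _×_; _,_)
open import Data.Sum using (_⊎_)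
open import Function.Bundles using (_⇔_)
open import Function.Definitions using (Injective)
open import Relation.Binary.PropositionalEquality using (_≡_; _≢_)
open import Relation.Nullary using (¬_)

record Graph (n : ℕ) : Set where
  field
    adj    : Fin n → Fin n → Bool
    sym    : ∀ i j → adj i j ≡ adj j i
    irrefl : ∀ i → adj i i ≡ false
open Graph public

Adj : ∀ {n} → Graph n → Fin n → Fin n → Set
Adj G i j = adj G i j ≡ true

_∖_ : ∀ {m} → Graph (suc m) → Fin (suc m) → Graph m
G ∖ v = record
  { adj    = λ i j → adj G (punchIn v i) (punchIn v j)
  ; sym    = λ i j → sym G (punchIn v i) (punchIn v j)
  ; irrefl = λ i → irrefl G (punchIn v i)
  }

-- i and j are consecutive positions on a cycle of length k (indices mod k).
CycNext : ∀ {k} → Fin k → Fin k → Set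
CycNext {k} i j = (suc (toℕ i) ≡ toℕ j) ⊎ (toℕ i ≡ 0 × suc (toℕ j) ≡ k)

CycAdj : ∀ {k} → Fin k → Fin k → Set
CycAdj i j = CycNext i j ⊎ CycNext j i

InducedCycle : ∀ {n} → Graph n → ℕ → Set
InducedCycle {n} G k =
  Σ (Fin k → Fin n) λ c →
    Injective _≡_ _≡_ c × (∀ i j → Adj G (c i) (c j) ⇔ CycAdj i j)

Chordal : ∀ {n} → Graph n → Set
Chordal G = ∀ k → 4 ≤ k → ¬ InducedCycle G k

Simplicial : ∀ {n} → Graph n → Fin n → Set
Simplicial G v = ∀ u w → Adj G v u → Adj G v w → u ≢ w → Adj G u w

Complete : ∀ {n} → Graph n → Set
Complete G = ∀ u w → u ≢ w → Adj G u w

IndepSimplicialSet : ∀ {n} → Graph n → Subset n → Set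
IndepSimplicialSet G S =
  (∀ u → u ∈ S → Simplicial G u) ×
  (∀ u w → u ∈ S → w ∈ S → ¬ Adj G u w)

ExactlyTwoIndepSimplicial : ∀ {n} → Graph n → Set
ExactlyTwoIndepSimplicial {n} G =
  (Σ (Subset n) λ S → IndepSimplicialSet G S × ∣ S ∣ ≡ 2) ×
  (∀ S → IndepSimplicialSet G S → ∣ S ∣ ≤ 2)

{-# OPTIONS --safe #-}

-- Deleting a vertex preserves chordality, and if G ∖ v is not complete, Dirac's lemma gives it
-- two non-adjacent simplicial vertices. Three pairwise non-adjacent simplicial vertices of G ∖ v
-- would give three in G: one not adjacent to v stays simplicial in G, and as N(v) is a clique
-- at most one of them is adjacent to v, and that one can be replaced by v itself.
--
-- Dirac's lemma is proved in the form: if x ∈ U has a non-neighbour y ∈ U, then G[U] has a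
-- simplicial vertex outside N[x]; applied twice, this gives two non-adjacent ones. By induction
-- on U: let C be the component of y in G[U ∖ N[x]] and S the set of neighbours of C in U, so
-- S ⊆ N(x). S is a clique, since two non-adjacent s, t ∈ S, an induced s–t path through C and x
-- would form an induced cycle of length at least 4. Of two non-adjacent simplicial vertices of
-- the smaller graph G[C ∪ S] one therefore lies in C, and it is simplicial in G[U] because all
-- its neighbours lie in C ∪ S.

module Submission where

open import Defs hiding (sym)
open import Data.Bool as Bool using (true)
open import Data.Empty using (⊥-elim)
open import Data.Fin using (Fin; zero; suc; toℕ; fromℕ; _≟_; punchIn; punchOut)
open import Data.Fin.Properties
  using (any?; toℕ-injective; toℕ-fromℕ; punchIn-injective; punchInᵢ≢i; punchIn-punchOut)
  renaming (suc-injective to fsuc-injective)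
open import Data.Fin.Subset
  using (Subset; Nonempty; _∈_; _∉_; _⊆_; _⊂_; _⊃_; ∣_∣; ⁅_⁆; _∪_; ⊤; inside; outside)
open import Data.Fin.Subset.Properties
  using (_∈?_; ∈⊤; x∈⁅x⁆; x∈⁅y⁆⇒x≡y; ∣⁅x⁆∣≡1; x∈p∪q⁻; x∈p∪q⁺; p⊆p∪q; q⊆p∪q; ∪-identityˡ)
open import Data.Fin.Subset.Induction using (Acc; acc; ⊂-wellFounded; ⊃-wellFounded)
open import Data.List using (List; []; _∷_; length; lookup)
open import Data.List.Membership.Propositional.Properties using (∈-lookup)
open import Data.List.Relation.Unary.All as All using (All; []; _∷_)
open import Data.List.Relation.Unary.All.Properties using (¬Any⇒All¬)
open import Data.List.Relation.Unary.Any using (Any; here; there) renaming (any? to anyL?)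
open import Data.Nat using (ℕ; zero; suc; _≤_; _≤?_; s≤s; z≤n)
open import Data.Nat.Properties using (suc-injective; ≰⇒>)
open import Data.Product using (Σ; ∃; ∃₂; _×_; _,_; proj₁; proj₂)
open import Data.Sum as Sum using (_⊎_; inj₁; inj₂; swap)
open import Data.Vec using (_∷_; here; there; tabulate)
open import Data.Vec.Properties using (lookup∘tabulate; lookup⇒[]=; []=⇒lookup)
open import Function using (_∘_)
open import Function.Bundles using (_⇔_; mk⇔; Equivalence)
open import Relation.Binary.Construct.Closure.ReflexiveTransitive
  using (Star; ε; _◅_; _◅◅_; map; reverse)
open import Relation.Binary.PropositionalEquality using (_≡_; _≢_; refl; sym; trans; cong; subst)
open import Relation.Nullary using (Dec; yes; no; does; ¬_; contradiction)
open import Relation.Nullary.Decidable using (dec-true; _×-dec_; _⊎-dec_; ¬?; decidable-stable)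
open import Relation.Unary using (Decidable)

private
  variable
    n : ℕ

subsetOf : {P : Fin n → Set} → Decidable P → Subset n
subsetOf P? = tabulate (λ z → does (P? z))

module _ {P : Fin n → Set} (P? : Decidable P) where

  ∈-subsetOf⁺ : ∀ {z} → P z → z ∈ subsetOf P?
  ∈-subsetOf⁺ {z} pz = lookup⇒[]= z _ (trans (lookup∘tabulate _ z) (dec-true (P? z) pz))

  ∈-subsetOf⁻ : ∀ {z} → z ∈ subsetOf P? → P z
  ∈-subsetOf⁻ {z} z∈ with P? z | trans (sym (lookup∘tabulate _ z)) ([]=⇒lookup z∈)
  ... | yes pz | _ = pz

∣⁅x⁆∪p∣≡1+∣p∣ : ∀ {x : Fin n} {p} → x ∉ p → ∣ ⁅ x ⁆ ∪ p ∣ ≡ suc ∣ p ∣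
∣⁅x⁆∪p∣≡1+∣p∣ {x = zero} {inside ∷ p} x∉p = contradiction here x∉p
∣⁅x⁆∪p∣≡1+∣p∣ {x = zero} {outside ∷ p} x∉p = cong (λ q → suc ∣ q ∣) (∪-identityˡ p)
∣⁅x⁆∪p∣≡1+∣p∣ {x = suc x} {inside ∷ p} x∉p = cong suc (∣⁅x⁆∪p∣≡1+∣p∣ (λ x∈p → x∉p (there x∈p)))
∣⁅x⁆∪p∣≡1+∣p∣ {x = suc x} {outside ∷ p} x∉p = ∣⁅x⁆∪p∣≡1+∣p∣ (λ x∈p → x∉p (there x∈p))

∈⁅x⁆∪p⁻ : ∀ {x z : Fin n} p → z ∈ ⁅ x ⁆ ∪ p → z ≡ x ⊎ z ∈ p
∈⁅x⁆∪p⁻ p z∈ = Sum.map₁ (x∈⁅y⁆⇒x≡y _) (x∈p∪q⁻ _ p z∈)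

∣p∣≥1⇒Nonempty : ∀ {p : Subset n} → 1 ≤ ∣ p ∣ → Nonempty p
∣p∣≥1⇒Nonempty {p = inside ∷ p} _ = zero , here
∣p∣≥1⇒Nonempty {p = outside ∷ p} h with ∣p∣≥1⇒Nonempty h
... | a , a∈p = suc a , there a∈p

∣p∣≥2⇒distinctPair : ∀ {p : Subset n} → 2 ≤ ∣ p ∣ → ∃₂ λ a b → a ∈ p × b ∈ p × a ≢ b
∣p∣≥2⇒distinctPair {p = inside ∷ p} (s≤s h) with ∣p∣≥1⇒Nonempty h
... | a , a∈p = zero , suc a , here , there a∈p , λ ()
∣p∣≥2⇒distinctPair {p = outside ∷ p} h with ∣p∣≥2⇒distinctPair h
... | a , b , a∈p , b∈p , a≢b = suc a , suc b , there a∈p , there b∈p , a≢b ∘ fsuc-injective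

∣p∣≥3⇒distinctTriple : ∀ {p : Subset n} → 3 ≤ ∣ p ∣ →
  ∃₂ λ a b → ∃ λ c → a ∈ p × b ∈ p × c ∈ p × a ≢ b × a ≢ c × b ≢ c
∣p∣≥3⇒distinctTriple {p = inside ∷ p} (s≤s h) with ∣p∣≥2⇒distinctPair h
... | b , c , b∈p , c∈p , b≢c =
  zero , suc b , suc c , here , there b∈p , there c∈p , (λ ()) , (λ ()) , b≢c ∘ fsuc-injective
∣p∣≥3⇒distinctTriple {p = outside ∷ p} h with ∣p∣≥3⇒distinctTriple h
... | a , b , c , a∈p , b∈p , c∈p , a≢b , a≢c , b≢c =
  suc a , suc b , suc c , there a∈p , there b∈p , there c∈p ,
  a≢b ∘ fsuc-injective , a≢c ∘ fsuc-injective , b≢c ∘ fsuc-injective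

module _ (G : Graph n) where

  Adj-sym : ∀ {u w} → Adj G u w → Adj G w u
  Adj-sym {u} {w} = trans (Graph.sym G w u)

  Adj-irrefl : ∀ {u} → ¬ Adj G u u
  Adj-irrefl {u} uu with trans (sym (irrefl G u)) uu
  ... | ()

  Adj? : ∀ u w → Dec (Adj G u w)
  Adj? u w = adj G u w Bool.≟ true

  Independent : Fin n → Fin n → Set
  Independent a b = a ≢ b × ¬ Adj G a b

  Independent-sym : ∀ {a b} → Independent a b → Independent b a
  Independent-sym (a≢b , ¬ab) = a≢b ∘ sym , ¬ab ∘ Adj-sym

  Independent? : ∀ a b → Dec (Independent a b)
  Independent? a b = ¬? (a ≟ b) ×-dec ¬? (Adj? a b)

  independentPair-or-clique : ∀ (U : Subset n) →
    (∃₂ λ a b → a ∈ U × b ∈ U × Independent a b) ⊎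
    (∀ {a b} → a ∈ U → b ∈ U → a ≢ b → Adj G a b)
  independentPair-or-clique U
    with any? (λ a → any? λ b → (a ∈? U) ×-dec (b ∈? U) ×-dec Independent? a b)
  ... | yes (a , b , pair) = inj₁ (a , b , pair)
  ... | no ¬pair = inj₂ λ {a} {b} a∈U b∈U a≢b →
    decidable-stable (Adj? a b) λ ¬ab → ¬pair (a , b , a∈U , b∈U , a≢b , ¬ab)

  EdgeIn : (Fin n → Set) → Fin n → Fin n → Set
  EdgeIn P a b = P a × Adj G a b × P b

  WalkIn : (Fin n → Set) → Fin n → Fin n → Set
  WalkIn P = Star (EdgeIn P)

  EdgeIn-sym : ∀ {P a b} → EdgeIn P a b → EdgeIn P b a
  EdgeIn-sym (Pa , ab , Pb) = Pb , Adj-sym ab , Pa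

  WalkIn-map : ∀ {P Q : Fin n → Set} → (∀ {z} → P z → Q z) → ∀ {a b} → WalkIn P a b → WalkIn Q a b
  WalkIn-map f = map λ (Pa , ab , Pb) → f Pa , ab , f Pb

  -- an induced path from a to b with vertex list a ∷ l
  data InducedPath : Fin n → Fin n → List (Fin n) → Set where
    [_]  : ∀ a → InducedPath a a []
    cons : ∀ {a h b l} → Adj G a h → InducedPath h b l → All (Independent a) l →
           InducedPath a b (h ∷ l)

  private
    Meets : Fin n → Fin n → Set
    Meets a z = a ≡ z ⊎ Adj G a z

    Meets? : ∀ a z → Dec (Meets a z)
    Meets? a z = (a ≟ z) ⊎-dec Adj? a z

    ¬meets⇒independent : ∀ {a z} → ¬ Meets a z → Independent a z
    ¬meets⇒independent ¬m = ¬m ∘ inj₁ , ¬m ∘ inj₂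

  -- a is joined to the path at the last vertex meeting a, which keeps the result induced
  prepend : ∀ {P : Fin n → Set} a {h b l} → InducedPath h b l → All P (h ∷ l) → P a →
            Any (Meets a) (h ∷ l) → ∃ λ l′ → InducedPath a b l′ × All P (a ∷ l′)
  prepend a [ h ] Pl Pa (here (inj₁ refl)) = _ , [ a ] , Pa ∷ []
  prepend a [ h ] Pl Pa (here (inj₂ ah))   = _ , cons ah [ h ] [] , Pa ∷ Pl
  prepend a (cons {h = h′} {l = l} hh′ p far) (Ph ∷ Pl) Pa meets
    with anyL? (Meets? a) (h′ ∷ l) | meets
  ... | yes meets′ | _                = prepend a p Pl Pa meets′
  ... | no _       | here (inj₁ refl) = _ , cons hh′ p far , Ph ∷ Pl
  ... | no ¬meets′ | here (inj₂ ah)   =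
    _ , cons ah (cons hh′ p far) (All.map ¬meets⇒independent (¬Any⇒All¬ (h′ ∷ l) ¬meets′)) ,
    Pa ∷ Ph ∷ Pl
  ... | no ¬meets′ | there meets′     = contradiction meets′ ¬meets′

  walk⇒inducedPath : ∀ {P a b} → P a → WalkIn P a b → ∃ λ l → InducedPath a b l × All P (a ∷ l)
  walk⇒inducedPath Pa ε = _ , [ _ ] , Pa ∷ []
  walk⇒inducedPath Pa ((_ , ah , Ph) ◅ w) with walk⇒inducedPath Ph w
  ... | l , p , Pl = prepend _ p Pl Pa (here (inj₂ ah))

  Consecutive : ∀ {k} → Fin k → Fin k → Set
  Consecutive i j = suc (toℕ i) ≡ toℕ j ⊎ suc (toℕ j) ≡ toℕ i

  private
    at : ∀ {P : Fin n → Set} {l} → All P l → ∀ i → P (lookup l i)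
    at Pl i = All.lookup Pl (∈-lookup i)

  inducedPath-adj : ∀ {s t l} → InducedPath s t l → ∀ i j →
                    Adj G (lookup (s ∷ l) i) (lookup (s ∷ l) j) ⇔ Consecutive i j
  inducedPath-adj [ _ ]          zero          zero          =
    mk⇔ (⊥-elim ∘ Adj-irrefl) λ { (inj₁ ()) ; (inj₂ ()) }
  inducedPath-adj (cons _ _ _)   zero          zero          =
    mk⇔ (⊥-elim ∘ Adj-irrefl) λ { (inj₁ ()) ; (inj₂ ()) }
  inducedPath-adj (cons ah _ _)  zero          (suc zero)    = mk⇔ (λ _ → inj₁ refl) (λ _ → ah)
  inducedPath-adj (cons _ _ far) zero          (suc (suc j)) =
    mk⇔ (⊥-elim ∘ proj₂ (at far j)) λ { (inj₁ ()) ; (inj₂ ()) }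
  inducedPath-adj (cons ah _ _)  (suc zero)    zero          =
    mk⇔ (λ _ → inj₂ refl) (λ _ → Adj-sym ah)
  inducedPath-adj (cons _ _ far) (suc (suc i)) zero          =
    mk⇔ (⊥-elim ∘ proj₂ (at far i) ∘ Adj-sym) λ { (inj₁ ()) ; (inj₂ ()) }
  inducedPath-adj (cons _ p _)   (suc i)       (suc j)       =
    mk⇔ (Sum.map (cong suc) (cong suc) ∘ to) (from ∘ Sum.map suc-injective suc-injective)
    where open Equivalence (inducedPath-adj p i j)

  inducedPath-injective : ∀ {s t l} → InducedPath s t l → ∀ i j →
                          lookup (s ∷ l) i ≡ lookup (s ∷ l) j → i ≡ j
  inducedPath-injective [ _ ]          zero          zero          _    = refl
  inducedPath-injective (cons _ _ _)   zero          zero          _    = refl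
  inducedPath-injective (cons ah _ _)  zero          (suc zero)    refl = contradiction ah Adj-irrefl
  inducedPath-injective (cons _ _ far) zero          (suc (suc j)) eq   =
    contradiction eq (proj₁ (at far j))
  inducedPath-injective (cons ah _ _)  (suc zero)    zero          refl = contradiction ah Adj-irrefl
  inducedPath-injective (cons _ _ far) (suc (suc i)) zero          eq   =
    contradiction (sym eq) (proj₁ (at far i))
  inducedPath-injective (cons _ p _)   (suc i)       (suc j)       eq   =
    cong suc (inducedPath-injective p i j eq)

  inducedPath-last : ∀ {s t l} → InducedPath s t l → lookup (s ∷ l) (fromℕ (length l)) ≡ t
  inducedPath-last [ _ ]        = refl
  inducedPath-last (cons _ p _) = inducedPath-last p

  inducedPath-length : ∀ {s t l} → InducedPath s t l → Independent s t → 2 ≤ length l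
  inducedPath-length [ _ ]                 (s≢s , _) = contradiction refl s≢s
  inducedPath-length (cons st [ _ ] _)     (_ , ¬st) = contradiction st ¬st
  inducedPath-length (cons _ (cons _ _ _) _) _       = s≤s (s≤s z≤n)

  ExceptEnds : (Fin n → Set) → Fin n → Fin n → Fin n → Set
  ExceptEnds Q s t z = z ≡ s ⊎ z ≡ t ⊎ Q z

  module ApexCycle {x s t l} (p : InducedPath s t l) (xs : Adj G x s) (xt : Adj G x t)
                   (rim : All (ExceptEnds (Independent x) s t) (s ∷ l)) where

    path : Fin (suc (length l)) → Fin n
    path = lookup (s ∷ l)

    cycle : Fin (suc (suc (length l))) → Fin n
    cycle zero    = x
    cycle (suc i) = path i

    apex-adj : ∀ j → Adj G x (path j) ⇔ (toℕ j ≡ 0 ⊎ toℕ j ≡ length l)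
    apex-adj j = mk⇔ to from
      where
      to : Adj G x (path j) → toℕ j ≡ 0 ⊎ toℕ j ≡ length l
      to xj with at rim j
      ... | inj₁ j≡s           = inj₁ (cong toℕ (inducedPath-injective p j zero j≡s))
      ... | inj₂ (inj₁ j≡t)    = inj₂ (trans (cong toℕ j≡last) (toℕ-fromℕ (length l)))
        where
        j≡last : j ≡ fromℕ (length l)
        j≡last = inducedPath-injective p j (fromℕ (length l)) (trans j≡t (sym (inducedPath-last p)))
      ... | inj₂ (inj₂ (_ , ¬xj)) = contradiction xj ¬xj
      from : toℕ j ≡ 0 ⊎ toℕ j ≡ length l → Adj G x (path j)
      from (inj₁ j≡0) rewrite toℕ-injective {i = j} {j = zero} j≡0 = xs
      from (inj₂ j≡L) rewrite toℕ-injective (trans j≡L (sym (toℕ-fromℕ (length l)))) =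
        subst (Adj G x) (sym (inducedPath-last p)) xt

    apex∉path : ∀ j → x ≢ path j
    apex∉path j x≡j with at rim j
    ... | inj₁ j≡s              = Adj-irrefl (subst (Adj G x) (sym (trans x≡j j≡s)) xs)
    ... | inj₂ (inj₁ j≡t)       = Adj-irrefl (subst (Adj G x) (sym (trans x≡j j≡t)) xt)
    ... | inj₂ (inj₂ (x≢j , _)) = x≢j x≡j

    cycle-injective : ∀ {i j} → cycle i ≡ cycle j → i ≡ j
    cycle-injective {zero}  {zero}  _  = refl
    cycle-injective {zero}  {suc j} eq = contradiction eq (apex∉path j)
    cycle-injective {suc i} {zero}  eq = contradiction (sym eq) (apex∉path i)
    cycle-injective {suc i} {suc j} eq = cong suc (inducedPath-injective p i j eq)

    apex-cycleAdj : ∀ j → Adj G x (path j) ⇔ CycAdj zero (suc j)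
    apex-cycleAdj j = mk⇔ to from
      where
      open Equivalence (apex-adj j) renaming (to to to′; from to from′)
      to : Adj G x (path j) → CycAdj zero (suc j)
      to xj with to′ xj
      ... | inj₁ j≡0 = inj₁ (inj₁ (cong suc (sym j≡0)))
      ... | inj₂ j≡L = inj₁ (inj₂ (refl , cong (λ k → suc (suc k)) j≡L))
      from : CycAdj zero (suc j) → Adj G x (path j)
      from (inj₁ (inj₁ 1≡1+j))      = from′ (inj₁ (sym (suc-injective 1≡1+j)))
      from (inj₁ (inj₂ (_ , j≡L)))  = from′ (inj₂ (suc-injective (suc-injective j≡L)))
      from (inj₂ (inj₁ ()))
      from (inj₂ (inj₂ (() , _)))

    cycle-adj : ∀ i j → Adj G (cycle i) (cycle j) ⇔ CycAdj i j
    cycle-adj zero    zero    = mk⇔ (⊥-elim ∘ Adj-irrefl) λ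
      { (inj₁ (inj₁ ())) ; (inj₁ (inj₂ (_ , ()))) ; (inj₂ (inj₁ ())) ; (inj₂ (inj₂ (_ , ()))) }
    cycle-adj zero    (suc j) = apex-cycleAdj j
    cycle-adj (suc i) zero    = mk⇔ (swap ∘ to ∘ Adj-sym) (Adj-sym ∘ from ∘ swap)
      where open Equivalence (apex-cycleAdj i)
    cycle-adj (suc i) (suc j) =
      mk⇔ (Sum.map (inj₁ ∘ cong suc) (inj₁ ∘ cong suc) ∘ to) (from ∘ consecutive)
      where
      open Equivalence (inducedPath-adj p i j)
      consecutive : CycAdj (suc i) (suc j) → Consecutive i j
      consecutive (inj₁ (inj₁ i+1≡j)) = inj₁ (suc-injective i+1≡j)
      consecutive (inj₂ (inj₁ j+1≡i)) = inj₂ (suc-injective j+1≡i)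
      consecutive (inj₁ (inj₂ (() , _)))
      consecutive (inj₂ (inj₂ (() , _)))

    inducedCycle : InducedCycle G (suc (suc (length l)))
    inducedCycle = cycle , cycle-injective , cycle-adj

  -- two neighbours of x joined by a path outside N[x] close an induced cycle through x unless adjacent
  linkedNeighbours-adjacent : Chordal G → ∀ {x s t} → Adj G x s → Adj G x t → s ≢ t →
    WalkIn (ExceptEnds (Independent x) s t) s t → Adj G s t
  linkedNeighbours-adjacent chordal {s = s} {t} xs xt s≢t w = decidable-stable (Adj? s t) λ ¬st →
    let l , p , rim = walk⇒inducedPath (inj₁ refl) w
    in chordal _ (s≤s (s≤s (inducedPath-length p (s≢t , ¬st)))) (ApexCycle.inducedCycle p xs xt rim)

  record IsComponent (R : Subset n) (y : Fin n) (C : Subset n) : Set where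
    field
      root∈  : y ∈ C
      ⊆R     : C ⊆ R
      linked : ∀ {z} → z ∈ C → WalkIn (_∈ R) z y
      closed : ∀ {u w} → u ∈ C → w ∈ R → Adj G u w → w ∈ C

  component : ∀ R {y} → y ∈ R → ∃ (IsComponent R y)
  component R {y} y∈R = grow ⁅ y ⁆ (x∈⁅x⁆ y) ⁅y⁆⊆R linked₀ (⊃-wellFounded _)
    where
    ⁅y⁆⊆R : ⁅ y ⁆ ⊆ R
    ⁅y⁆⊆R z∈ rewrite x∈⁅y⁆⇒x≡y y z∈ = y∈R

    linked₀ : ∀ {z} → z ∈ ⁅ y ⁆ → WalkIn (_∈ R) z y
    linked₀ z∈ rewrite x∈⁅y⁆⇒x≡y y z∈ = ε

    grow : ∀ C → y ∈ C → C ⊆ R → (∀ {z} → z ∈ C → WalkIn (_∈ R) z y) → Acc _⊃_ C →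
           ∃ (IsComponent R y)
    grow C y∈C C⊆R linked (acc rec)
      with any? (λ u → any? λ w → (u ∈? C) ×-dec (w ∈? R) ×-dec ¬? (w ∈? C) ×-dec Adj? u w)
    ... | no ¬exit = C , record { root∈ = y∈C ; ⊆R = C⊆R ; linked = linked ; closed = closed }
      where
      closed : ∀ {u w} → u ∈ C → w ∈ R → Adj G u w → w ∈ C
      closed {u} {w} u∈C w∈R uw =
        decidable-stable (w ∈? C) λ w∉C → ¬exit (u , w , u∈C , w∈R , w∉C , uw)
    ... | yes (u , w , u∈C , w∈R , w∉C , uw) =
      grow (⁅ w ⁆ ∪ C) (q⊆p∪q _ _ y∈C) C′⊆R linked′ (rec (q⊆p∪q _ _ , w , p⊆p∪q C (x∈⁅x⁆ w) , w∉C))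
      where
      C′⊆R : ⁅ w ⁆ ∪ C ⊆ R
      C′⊆R z∈ with ∈⁅x⁆∪p⁻ C z∈
      ... | inj₁ refl = w∈R
      ... | inj₂ z∈C  = C⊆R z∈C

      linked′ : ∀ {z} → z ∈ ⁅ w ⁆ ∪ C → WalkIn (_∈ R) z y
      linked′ z∈ with ∈⁅x⁆∪p⁻ C z∈
      ... | inj₁ refl = (w∈R , Adj-sym uw , C⊆R u∈C) ◅ linked u∈C
      ... | inj₂ z∈C  = linked z∈C

  SimplicialIn : Subset n → Fin n → Set
  SimplicialIn U c = ∀ {u w} → u ∈ U → w ∈ U → Adj G c u → Adj G c w → u ≢ w → Adj G u w

  FarSimplicial : Subset n → Set
  FarSimplicial U = ∀ {x y} → x ∈ U → y ∈ U → Independent x y →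
                    ∃ λ c → c ∈ U × Independent x c × SimplicialIn U c

  IndepSimplicialPairIn : Subset n → Set
  IndepSimplicialPairIn U =
    ∃₂ λ a b → a ∈ U × b ∈ U × Independent a b × SimplicialIn U a × SimplicialIn U b

  farSimplicial⇒pair : ∀ {U x y} → FarSimplicial U → x ∈ U → y ∈ U → Independent x y →
                       IndepSimplicialPairIn U
  farSimplicial⇒pair far x∈U y∈U xy with far x∈U y∈U xy
  ... | c , c∈U , xc , sc with far c∈U x∈U (Independent-sym xc)
  ...   | d , d∈U , cd , sd = c , d , c∈U , d∈U , cd , sc , sd

  module FarSimplicialStep (chordal : Chordal G) {U} (ih : ∀ {U′} → U′ ⊂ U → FarSimplicial U′)
                           {x y} (x∈U : x ∈ U) (y∈U : y ∈ U) (xy : Independent x y) where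

    R? : ∀ z → Dec (z ∈ U × Independent x z)
    R? z = (z ∈? U) ×-dec Independent? x z

    R : Subset n
    R = subsetOf R?

    C : Subset n
    C = proj₁ (component R (∈-subsetOf⁺ R? (y∈U , xy)))

    open IsComponent (proj₂ (component R (∈-subsetOf⁺ R? (y∈U , xy))))

    S? : ∀ z → Dec (z ∈ U × Adj G x z × ∃ λ u → u ∈ C × Adj G z u)
    S? z = (z ∈? U) ×-dec Adj? x z ×-dec any? (λ u → (u ∈? C) ×-dec Adj? z u)

    S : Subset n
    S = subsetOf S?

    U′ : Subset n
    U′ = C ∪ S

    C-far : ∀ {z} → z ∈ C → z ∈ U × Independent x z
    C-far = ∈-subsetOf⁻ R? ∘ ⊆R

    S-clique : ∀ {s t} → s ∈ S → t ∈ S → s ≢ t → Adj G s t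
    S-clique {s} {t} s∈S t∈S s≢t with ∈-subsetOf⁻ S? s∈S | ∈-subsetOf⁻ S? t∈S
    ... | _ , xs , u , u∈C , su | _ , xt , w , w∈C , tw =
      linkedNeighbours-adjacent chordal xs xt s≢t
        ((inj₁ refl , su , rim (⊆R u∈C)) ◅ WalkIn-map rim (linked u∈C)
          ◅◅ reverse EdgeIn-sym ((inj₂ (inj₁ refl) , tw , rim (⊆R w∈C)) ◅ WalkIn-map rim (linked w∈C)))
      where
      rim : ∀ {z} → z ∈ R → ExceptEnds (Independent x) s t z
      rim = inj₂ ∘ inj₂ ∘ proj₂ ∘ ∈-subsetOf⁻ R?

    U′⊂U : U′ ⊂ U
    U′⊂U = U′⊆U , x , x∈U , x∉U′
      where
      U′⊆U : U′ ⊆ U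
      U′⊆U z∈ with x∈p∪q⁻ C S z∈
      ... | inj₁ z∈C = proj₁ (C-far z∈C)
      ... | inj₂ z∈S = proj₁ (∈-subsetOf⁻ S? z∈S)

      x∉U′ : x ∉ U′
      x∉U′ x∈ with x∈p∪q⁻ C S x∈
      ... | inj₁ x∈C = proj₁ (proj₂ (C-far x∈C)) refl
      ... | inj₂ x∈S = Adj-irrefl (proj₁ (proj₂ (∈-subsetOf⁻ S? x∈S)))

    C-neighbours : ∀ {c w} → c ∈ C → w ∈ U → Adj G c w → w ∈ U′
    C-neighbours {c} {w} c∈C w∈U cw with w ≟ x | Adj? x w
    ... | yes refl | _      = contradiction (Adj-sym cw) (proj₂ (proj₂ (C-far c∈C)))
    ... | no _     | yes xw = x∈p∪q⁺ (inj₂ (∈-subsetOf⁺ S? (w∈U , xw , c , c∈C , Adj-sym cw)))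
    ... | no w≢x   | no ¬xw = x∈p∪q⁺ (inj₁ (closed c∈C (∈-subsetOf⁺ R? (w∈U , w≢x ∘ sym , ¬xw)) cw))

    simplicialInC : ∃ λ c → c ∈ C × SimplicialIn U′ c
    simplicialInC with independentPair-or-clique U′
    ... | inj₂ clique = y , root∈ , λ u∈ w∈ _ _ → clique u∈ w∈
    ... | inj₁ (a , b , a∈ , b∈ , ab) with farSimplicial⇒pair (ih U′⊂U) a∈ b∈ ab
    ...   | c , d , c∈ , d∈ , (c≢d , ¬cd) , sc , sd with x∈p∪q⁻ C S c∈ | x∈p∪q⁻ C S d∈
    ...     | inj₁ c∈C | _        = c , c∈C , sc
    ...     | inj₂ _   | inj₁ d∈C = d , d∈C , sd
    ...     | inj₂ c∈S | inj₂ d∈S = contradiction (S-clique c∈S d∈S c≢d) ¬cd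

    farSimplicialVertex : ∃ λ c → c ∈ U × Independent x c × SimplicialIn U c
    farSimplicialVertex with simplicialInC
    ... | c , c∈C , sc = c , proj₁ (C-far c∈C) , proj₂ (C-far c∈C) ,
      λ u∈U w∈U cu cw → sc (C-neighbours c∈C u∈U cu) (C-neighbours c∈C w∈U cw) cu cw

  farSimplicial : Chordal G → ∀ U → FarSimplicial U
  farSimplicial chordal U = go U (⊂-wellFounded U)
    where
    go : ∀ U → Acc _⊂_ U → FarSimplicial U
    go U (acc rec) = FarSimplicialStep.farSimplicialVertex chordal (λ {U′} U′⊂U → go U′ (rec U′⊂U))

  IndepSimplicialPair : Set
  IndepSimplicialPair = ∃₂ λ a b → Independent a b × Simplicial G a × Simplicial G b

  dirac : Chordal G → ∀ {x y} → Independent x y → IndepSimplicialPair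
  dirac chordal xy = simplicialIn⊤ (farSimplicial⇒pair (farSimplicial chordal ⊤) ∈⊤ ∈⊤ xy)
    where
    simplicialIn⊤ : IndepSimplicialPairIn ⊤ → IndepSimplicialPair
    simplicialIn⊤ (a , b , _ , _ , ab , sa , sb) = a , b , ab , (λ _ _ → sa ∈⊤ ∈⊤) , (λ _ _ → sb ∈⊤ ∈⊤)

record IndepSimplicialTriple (G : Graph n) : Set where
  field
    {a b c}    : Fin n
    ab         : Independent G a b
    ac         : Independent G a c
    bc         : Independent G b c
    sa         : Simplicial G a
    sb         : Simplicial G b
    sc         : Simplicial G c

module _ (G : Graph n) where

  IndepSimplicialSetOfSize : ℕ → Set
  IndepSimplicialSetOfSize k = Σ (Subset n) λ S → IndepSimplicialSet G S × ∣ S ∣ ≡ k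

  private
    on⁅⁆ : ∀ {P : Fin n → Set} {b} → P b → ∀ {u} → u ∈ ⁅ b ⁆ → P u
    on⁅⁆ Pb u∈ rewrite x∈⁅y⁆⇒x≡y _ u∈ = Pb

  singleton : ∀ {a} → Simplicial G a → IndepSimplicialSetOfSize 1
  singleton {a} sa = ⁅ a ⁆ , ((λ _ → on⁅⁆ sa) , indep) , ∣⁅x⁆∣≡1 a
    where
    indep : ∀ u w → u ∈ ⁅ a ⁆ → w ∈ ⁅ a ⁆ → ¬ Adj G u w
    indep u w u∈ w∈ rewrite x∈⁅y⁆⇒x≡y a u∈ | x∈⁅y⁆⇒x≡y a w∈ = Adj-irrefl G

  extend : ∀ {k a} ((S , _) : IndepSimplicialSetOfSize k) → Simplicial G a →
           (∀ {u} → u ∈ S → Independent G a u) → IndepSimplicialSetOfSize (suc k)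
  extend {a = a} (S , (simp , indep) , ∣S∣≡k) sa a-S =
    ⁅ a ⁆ ∪ S , (simp′ , indep′) , trans (∣⁅x⁆∪p∣≡1+∣p∣ (λ a∈S → proj₁ (a-S a∈S) refl)) (cong suc ∣S∣≡k)
    where
    simp′ : ∀ u → u ∈ ⁅ a ⁆ ∪ S → Simplicial G u
    simp′ u u∈ with ∈⁅x⁆∪p⁻ S u∈
    ... | inj₁ refl = sa
    ... | inj₂ u∈S  = simp u u∈S
    indep′ : ∀ u w → u ∈ ⁅ a ⁆ ∪ S → w ∈ ⁅ a ⁆ ∪ S → ¬ Adj G u w
    indep′ u w u∈ w∈ with ∈⁅x⁆∪p⁻ S u∈ | ∈⁅x⁆∪p⁻ S w∈
    ... | inj₁ refl | inj₁ refl = Adj-irrefl G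
    ... | inj₁ refl | inj₂ w∈S  = proj₂ (a-S w∈S)
    ... | inj₂ u∈S  | inj₁ refl = proj₂ (a-S u∈S) ∘ Adj-sym G
    ... | inj₂ u∈S  | inj₂ w∈S  = indep u w u∈S w∈S

  pair⇒indepSimplicialSet : IndepSimplicialPair G → IndepSimplicialSetOfSize 2
  pair⇒indepSimplicialSet (a , b , ab , sa , sb) = extend (singleton sb) sa (on⁅⁆ ab)

  triple⇒indepSimplicialSet : IndepSimplicialTriple G → IndepSimplicialSetOfSize 3
  triple⇒indepSimplicialSet t =
    extend (extend (singleton sc) sb (on⁅⁆ bc)) sa (Sum.[ on⁅⁆ ab , on⁅⁆ ac ] ∘ x∈p∪q⁻ _ _)
    where open IndepSimplicialTriple t

  bounded⇒noTriple : (∀ S → IndepSimplicialSet G S → ∣ S ∣ ≤ 2) → ¬ IndepSimplicialTriple G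
  bounded⇒noTriple bounded t with triple⇒indepSimplicialSet t
  ... | S , indep , ∣S∣≡3 with subst (_≤ 2) ∣S∣≡3 (bounded S indep)
  ...   | s≤s (s≤s ())

  noTriple⇒bounded : ¬ IndepSimplicialTriple G → ∀ S → IndepSimplicialSet G S → ∣ S ∣ ≤ 2
  noTriple⇒bounded ¬triple S (simp , indep) = decidable-stable (∣ S ∣ ≤? 2) λ ∣S∣≰2 →
    let a , b , c , a∈ , b∈ , c∈ , a≢b , a≢c , b≢c = ∣p∣≥3⇒distinctTriple (≰⇒> ∣S∣≰2)
    in ¬triple record
      { ab = a≢b , indep a b a∈ b∈ ; ac = a≢c , indep a c a∈ c∈ ; bc = b≢c , indep b c b∈ c∈
      ; sa = simp a a∈ ; sb = simp b b∈ ; sc = simp c c∈ }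

module _ (G : Graph (suc n)) (v : Fin (suc n)) where

  ∖-chordal : Chordal G → Chordal (G ∖ v)
  ∖-chordal chordal k k≥4 (c , c-injective , c-adj) =
    chordal k k≥4 (punchIn v ∘ c , c-injective ∘ punchIn-injective v _ _ , c-adj)

  private
    v≢punchIn : ∀ {p} → v ≢ punchIn v p
    v≢punchIn {p} = punchInᵢ≢i v p ∘ sym

    preimage : ∀ {u} → v ≢ u → ∃ λ u′ → punchIn v u′ ≡ u
    preimage v≢u = punchOut v≢u , punchIn-punchOut v≢u

  simplicial-∖⁻ : ∀ {p} → Simplicial (G ∖ v) p → ¬ Adj G v (punchIn v p) → Simplicial G (punchIn v p)
  simplicial-∖⁻ sp ¬vp u w pu pw u≢w
    with preimage {u} (λ { refl → ¬vp (Adj-sym G pu) }) | preimage {w} (λ { refl → ¬vp (Adj-sym G pw) })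
  ... | u′ , refl | w′ , refl = sp u′ w′ pu pw (u≢w ∘ cong (punchIn v))

  Represents : Fin n → Fin (suc n) → Set
  Represents p q = (Adj G v (punchIn v p) × q ≡ v) ⊎ (¬ Adj G v (punchIn v p) × q ≡ punchIn v p)

  representative : ∀ p → ∃ (Represents p)
  representative p with Adj? G v (punchIn v p)
  ... | yes vp = v , inj₁ (vp , refl)
  ... | no ¬vp = punchIn v p , inj₂ (¬vp , refl)

  lift : Fin n → Fin (suc n)
  lift p = proj₁ (representative p)

  module _ (sv : Simplicial G v) where

    Represents-simplicial : ∀ {p q} → Represents p q → Simplicial (G ∖ v) p → Simplicial G q
    Represents-simplicial (inj₁ (_ , refl))   _  = sv
    Represents-simplicial (inj₂ (¬vp , refl)) sp = simplicial-∖⁻ sp ¬vp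

    Represents-independent : ∀ {p p′ q q′} → Represents p q → Represents p′ q′ →
                             Independent (G ∖ v) p p′ → Independent G q q′
    Represents-independent {p} {p′} (inj₁ (vp , refl)) (inj₁ (vp′ , refl)) (p≢p′ , ¬pp′) =
      contradiction (sv (punchIn v p) (punchIn v p′) vp vp′ (p≢p′ ∘ punchIn-injective v p p′)) ¬pp′
    Represents-independent (inj₁ (_ , refl)) (inj₂ (¬vp′ , refl)) _ = v≢punchIn , ¬vp′
    Represents-independent (inj₂ (¬vp , refl)) (inj₁ (_ , refl)) _ = v≢punchIn ∘ sym , ¬vp ∘ Adj-sym G
    Represents-independent {p} {p′} (inj₂ (_ , refl)) (inj₂ (_ , refl)) (p≢p′ , ¬pp′) =
      p≢p′ ∘ punchIn-injective v p p′ , ¬pp′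

    lift-simplicial : ∀ {p} → Simplicial (G ∖ v) p → Simplicial G (lift p)
    lift-simplicial {p} = Represents-simplicial (proj₂ (representative p))

    lift-independent : ∀ {p p′} → Independent (G ∖ v) p p′ → Independent G (lift p) (lift p′)
    lift-independent {p} {p′} =
      Represents-independent (proj₂ (representative p)) (proj₂ (representative p′))

    triple-∖⁻ : IndepSimplicialTriple (G ∖ v) → IndepSimplicialTriple G
    triple-∖⁻ t = record
      { a = lift a ; b = lift b ; c = lift c
      ; ab = lift-independent ab ; ac = lift-independent ac ; bc = lift-independent bc
      ; sa = lift-simplicial sa  ; sb = lift-simplicial sb  ; sc = lift-simplicial sc }
      where open IndepSimplicialTriple t

lemma3p2 : ∀ {m} (G : Graph (suc m)) (v : Fin (suc m)) →
    Chordal G → Simplicial G v → ExactlyTwoIndepSimplicial G →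
    (Chordal (G ∖ v) × ExactlyTwoIndepSimplicial (G ∖ v)) ⊎ Complete (G ∖ v)
lemma3p2 G v chordal sv (_ , bounded) with independentPair-or-clique (G ∖ v) ⊤
... | inj₂ clique = inj₂ λ u w → clique ∈⊤ ∈⊤
... | inj₁ (a , b , _ , _ , ab) =
  inj₁ (chordal′ , pair⇒indepSimplicialSet (G ∖ v) (dirac (G ∖ v) chordal′ ab) ,
        noTriple⇒bounded (G ∖ v) (bounded⇒noTriple G bounded ∘ triple-∖⁻ G v sv))
  where
  chordal′ : Chordal (G ∖ v)
  chordal′ = ∖-chordal G v chordal
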